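{- Let $G$ and $H$ be nontrivial connected graphs. Let $u_1,u_2,u_3$ be three distinct vertices of $G$ and $v_1$ a vertex of $H$, and let $S=\{(u_1,v_1),(u_2,v_1),(u_3,v_1)\}\subseteq V(G\square H)$. Then the maximum number $\kappa(S)$ of internally disjoint $S$-trees in $G\square H$ satisfies $\kappa(S)\ge \kappa_3(G)+\delta(H)$.
   Context: All graphs are finite, simple and undirected; $\delta(H)$ is the minimum degree of $H$. For $S\subseteq V(X)$ in a graph $X$, an $S$-tree is a tree $T\subseteq X$ with $S\subseteq V(T)$; $S$-trees $T_1,\dots,T_r$ are internally disjoint if $E(T_i)\cap E(T_j)=\emptyset$ and $V(T_i)\cap V(T_j)=S$ for all $i\ne j$; $\kappa(S)$ is the maximum number of internally disjoint $S$-trees in $X$. $\kappa_3(G)$ is the minimum of $\kappa(S)$ (computed in $G$) over all 3-element subsets $S\subseteq V(G)$. The Cartesian product $G\square H$ has vertex set $V(G)\times V(H)$, with $(u,v)\sim(u',v')$ iff ($u=u'$ and $vv'\in E(H)$) or ($v=v'$ and $uu'\in E(G)$). -}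

module Defs where

open import Data.Nat using (ℕ; zero; suc; _+_; _*_; _≤_)
open import Data.Bool using (Bool; true; false; T; _∧_; _∨_; if_then_else_)
open import Data.Bool.Properties using (∧-zeroʳ)
open import Data.Fin using (Fin; inject₁; fromℕ) renaming (zero to fzero; suc to fsuc)
open import Data.Fin.Properties using (*↔×) renaming (_≟_ to _≟F_)
open import Data.List using (List; map; allFin)
open import Data.Nat.ListAction using (sum)
open import Data.Product using (Σ; Σ-syntax; ∃; _×_; _,_; proj₁; proj₂)
open import Data.Sum using (_⊎_)
open import Data.Empty using (⊥)
open import Function.Bundles using (_↔_; Inverse)
open import Function.Definitions using (Injective)
open import Function.Properties.Inverse using (↔-trans; ↔-sym)
open import Data.Product.Function.NonDependent.Propositional using (_×-↔_)
open import Relation.Nullary using (¬_; yes; no; Dec)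
open import Relation.Nullary.Decidable using (⌊_⌋)
open import Relation.Binary.PropositionalEquality using (_≡_; _≢_; refl; sym; cong₂)

record Graph : Set₁ where
  field
    V       : Set
    size    : ℕ
    enum    : V ↔ Fin size
    adj     : V → V → Bool
    adj-sym : ∀ x y → adj x y ≡ adj y x
    adj-irr : ∀ x → adj x x ≡ false

open Graph public

eqV : (X : Graph) → V X → V X → Bool
eqV X x y = ⌊ Inverse.to (enum X) x ≟F Inverse.to (enum X) y ⌋

private
  ≟-sym : ∀ {n} (a b : Fin n) → ⌊ a ≟F b ⌋ ≡ ⌊ b ≟F a ⌋
  ≟-sym a b with a ≟F b | b ≟F a
  ... | yes _ | yes _ = refl
  ... | no _  | no _  = refl
  ... | yes p | no q  = Data.Empty.⊥-elim (q (sym p))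
  ... | no p  | yes q = Data.Empty.⊥-elim (p (sym q))

  eqV-sym : (X : Graph) (x y : V X) → eqV X x y ≡ eqV X y x
  eqV-sym X x y = ≟-sym (Inverse.to (enum X) x) (Inverse.to (enum X) y)

_□_ : Graph → Graph → Graph
G □ H = record
  { V       = V G × V H
  ; size    = size G * size H
  ; enum    = ↔-trans (enum G ×-↔ enum H) (↔-sym *↔×)
  ; adj     = λ { (u , v) (u' , v') →
                  (eqV G u u' ∧ adj H v v') ∨ (eqV H v v' ∧ adj G u u') }
  ; adj-sym = λ { (u , v) (u' , v') →
                  cong₂ _∨_ (cong₂ _∧_ (eqV-sym G u u') (adj-sym H v v'))
                            (cong₂ _∧_ (eqV-sym H v v') (adj-sym G u u')) }
  ; adj-irr = λ { (u , v) → lemma (eqV G u u) (eqV H v v) (adj-irr H v) (adj-irr G u) }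
  }
  where
  lemma : ∀ a b {c d} → c ≡ false → d ≡ false → (a ∧ c) ∨ (b ∧ d) ≡ false
  lemma a b refl refl rewrite ∧-zeroʳ a | ∧-zeroʳ b = refl

data Walk {A : Set} (R : A → A → Set) : A → A → Set where
  here : ∀ {x} → Walk R x x
  step : ∀ {x y z} → R x y → Walk R y z → Walk R x z

Connected : Graph → Set
Connected X = ∀ (x y : V X) → Walk (λ a b → T (adj X a b)) x y

Nontrivial : Graph → Set
Nontrivial X = 2 ≤ size X

deg : (X : Graph) → V X → ℕ
deg X v = sum (map (λ i → if adj X v (Inverse.from (enum X) i) then 1 else 0) (allFin (size X)))

IsMinDeg : Graph → ℕ → Set
IsMinDeg X d = (∀ v → d ≤ deg X v) × (Σ[ v ∈ V X ] deg X v ≡ d)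

record Subgraph (X : Graph) : Set where
  field
    inV    : V X → Bool
    inE    : V X → V X → Bool
    E-sym  : ∀ x y → inE x y ≡ inE y x
    E-adj  : ∀ x y → T (inE x y) → T (adj X x y)
    E-ends : ∀ x y → T (inE x y) → T (inV x)

open Subgraph public

SubConnected : {X : Graph} → Subgraph X → Set
SubConnected {X} T' = ∀ (x y : V X) → T (inV T' x) → T (inV T' y)
                      → Walk (λ a b → T (inE T' a b)) x y

Cycle : {X : Graph} → Subgraph X → Set
Cycle {X} T' = Σ[ k ∈ ℕ ] Σ[ c ∈ (Fin (3 + k) → V X) ]
                 Injective _≡_ _≡_ c
               × (∀ (i : Fin (2 + k)) → T (inE T' (c (inject₁ i)) (c (fsuc i))))
               × T (inE T' (c (fromℕ (2 + k))) (c fzero))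

IsTree : {X : Graph} → Subgraph X → Set
IsTree T' = SubConnected T' × ¬ Cycle T'

record STree (X : Graph) (S : V X → Set) : Set where
  field
    tree  : Subgraph X
    isTree : IsTree tree
    S⊆V   : ∀ x → S x → T (inV tree x)

open STree public

-- T₁, T₂ internally disjoint: no common edge, and common vertices lie in S
-- (together with S ⊆ V(Tᵢ) this is V(T₁) ∩ V(T₂) = S)
InternallyDisjoint : {X : Graph} {S : V X → Set} → STree X S → STree X S → Set
InternallyDisjoint {X} {S} T₁ T₂ =
    (∀ x y → T (inE (tree T₁) x y) → T (inE (tree T₂) x y) → ⊥)
  × (∀ x → T (inV (tree T₁) x) → T (inV (tree T₂) x) → S x)

HasTrees : (X : Graph) → (V X → Set) → ℕ → Set
HasTrees X S r = Σ[ ts ∈ (Fin r → STree X S) ]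
                   (∀ i j → i ≢ j → InternallyDisjoint (ts i) (ts j))

IsKappa : (X : Graph) → (V X → Set) → ℕ → Set
IsKappa X S k = HasTrees X S k × (∀ r → HasTrees X S r → r ≤ k)

Three : {A : Set} → A → A → A → A → Set
Three a b c x = x ≡ a ⊎ x ≡ b ⊎ x ≡ c

Distinct3 : {A : Set} → A → A → A → Set
Distinct3 a b c = a ≢ b × a ≢ c × b ≢ c

IsKappa3 : Graph → ℕ → Set
IsKappa3 X k =
    (∀ a b c → Distinct3 a b c → ∀ m → IsKappa X (Three a b c) m → k ≤ m)
  × (Σ[ a ∈ V X ] Σ[ b ∈ V X ] Σ[ c ∈ V X ] Distinct3 a b c × IsKappa X (Three a b c) k)

-- Let S₀ = {u₁, u₂, u₃} and take κ₃(G) internally disjoint S₀-trees of G, together with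
-- δ(H) distinct neighbours w of v₁ in H. Copying each S₀-tree into the layer G × {v₁}
-- gives κ₃(G) trees for S. For each neighbour w, a spanning tree of the layer G × {w},
-- extended by the three edges (uᵢ, w) — (uᵢ, v₁), is one more S-tree. The copies live in
-- layer v₁, each extended spanning tree has all its edges touching its own layer w, and
-- its only vertices outside that layer are the three points of S, so all κ₃(G) + δ(H)
-- trees are internally disjoint.
--
-- Constructively, κ₃(G) ≤ κ(S₀) only yields the κ₃(G) trees of G under a double
-- negation; this is harmless because the goal is a decidable inequality.
module Submission where

open import Defs
open import Data.Bool using (Bool; true; false; T; _∧_; _∨_; not; if_then_else_)
open import Data.Bool.Properties using (T-∧; T-∨; ∧-comm; ∨-comm)
open import Data.Empty using (⊥; ⊥-elim)
open import Data.Fin using (Fin; inject₁; inject≤; fromℕ; toℕ) renaming (zero to fzero; suc to fsuc)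
open import Data.Fin.Properties using (toℕ-inject₁; inject≤-injective; suc-injective; +↔⊎)
  renaming (_≟_ to _≟F_)
open import Data.List using (List; tabulate; allFin)
open import Data.Bool.ListAction using (any)
open import Data.List.Extrema.Nat using (argmax; f[xs]≤f[argmax])
open import Data.List.Membership.Propositional.Properties using (∈-allFin)
open import Data.List.Properties using (map-tabulate)
open import Data.List.Relation.Unary.All as All using ()
open import Data.List.Relation.Unary.Any using (satisfied)
open import Data.List.Relation.Unary.Any.Properties using (any⁺; any⁻; tabulate⁺)
open import Data.Nat using (ℕ; zero; suc; _+_; _≤_; _<_; z≤n; s≤s)
open import Data.Nat.ListAction using (sum)
open import Data.Nat.Properties
  using (<⇒≢; <-irrefl; <-asym; <-≤-trans; ≤∧≢⇒<; n<1+n; m<n⇒m<1+n; ≰⇒>; _≤?_)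
open import Data.Product using (Σ-syntax; ∃-syntax; _×_; _,_; proj₁; proj₂)
open import Data.Sum using (_⊎_; inj₁; inj₂; [_,_])
open import Function using (_∘_)
open import Function.Bundles using (Inverse; Injection; Equivalence)
open import Function.Definitions using (Injective)
open import Function.Properties.Inverse using (↔⇒↣; ↔-sym)
open import Relation.Binary.Definitions using (DecidableEquality)
open import Relation.Nullary using (¬_; yes; no)
open import Relation.Nullary.Decidable using (⌊_⌋; map′; toWitness; fromWitness; _⊎-dec_; decidable-stable)
open import Relation.Nullary.Negation using (¬¬-map)
open import Relation.Unary using (Decidable)
open import Relation.Binary.PropositionalEquality using (_≡_; _≢_; refl; sym; trans; cong; cong₂; subst)

∧-intro : ∀ {a b} → T a → T b → T (a ∧ b)
∧-intro p q = Equivalence.from T-∧ (p , q)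

∧-elim : ∀ {a b} → T (a ∧ b) → T a × T b
∧-elim = Equivalence.to T-∧

∨-introˡ : ∀ {a b} → T a → T (a ∨ b)
∨-introˡ p = Equivalence.from T-∨ (inj₁ p)

∨-introʳ : ∀ {a b} → T b → T (a ∨ b)
∨-introʳ p = Equivalence.from T-∨ (inj₂ p)

∨-elim : ∀ {a b} → T (a ∨ b) → T a ⊎ T b
∨-elim = Equivalence.to T-∨

not-intro : ∀ {a} → ¬ T a → T (not a)
not-intro {false} _ = _
not-intro {true} ¬a = ¬a _

not-elim : ∀ {a} → T (not a) → ¬ T a
not-elim {false} _ ()

toV : (X : Graph) → V X → Fin (size X)
toV X = Inverse.to (enum X)

fromV : (X : Graph) → Fin (size X) → V X
fromV X = Inverse.from (enum X)

toV-injective : (X : Graph) → Injective _≡_ _≡_ (toV X)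
toV-injective X = Injection.injective (↔⇒↣ (enum X))

fromV-injective : (X : Graph) → Injective _≡_ _≡_ (fromV X)
fromV-injective X = Injection.injective (↔⇒↣ (↔-sym (enum X)))

decV : (X : Graph) → DecidableEquality (V X)
decV X x y = map′ (toV-injective X) (cong (toV X)) (toV X x ≟F toV X y)

eqV-sound : (X : Graph) {x y : V X} → T (eqV X x y) → x ≡ y
eqV-sound X t = toV-injective X (toWitness t)

eqV-complete : (X : Graph) {x y : V X} → x ≡ y → T (eqV X x y)
eqV-complete X x≡y = fromWitness (cong (toV X) x≡y)

vertices : (X : Graph) → List (V X)
vertices X = tabulate (fromV X)

any-vertex⁺ : (X : Graph) (p : V X → Bool) {x : V X} → T (p x) → T (any p (vertices X))
any-vertex⁺ X p {x} px =
  any⁺ p (tabulate⁺ (toV X x) (subst (T ∘ p) (sym (Inverse.strictlyInverseʳ (enum X) x)) px))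

any-vertex⁻ : (X : Graph) (p : V X → Bool) → T (any p (vertices X)) → ∃[ x ] T (p x)
any-vertex⁻ X p t = satisfied (any⁻ p (vertices X) t)

adj⇒≢ : (X : Graph) {x y : V X} → T (adj X x y) → x ≢ y
adj⇒≢ X {x} xy refl = subst T (adj-irr X x) xy

Edge : {X : Graph} → Subgraph X → V X → V X → Set
Edge F x y = T (inE F x y)

Edge-sym : {X : Graph} (F : Subgraph X) {x y : V X} → Edge F x y → Edge F y x
Edge-sym F {x} {y} = subst T (E-sym F x y)

_++ʷ_ : ∀ {A : Set} {R : A → A → Set} {x y z} → Walk R x y → Walk R y z → Walk R x z
here ++ʷ w = w
step e w ++ʷ w′ = step e (w ++ʷ w′)

reverseʷ : ∀ {A : Set} {R : A → A → Set} → (∀ {a b} → R a b → R b a) → ∀ {x y} → Walk R x y → Walk R y x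
reverseʷ sym-R here = here
reverseʷ sym-R (step e w) = reverseʷ sym-R w ++ʷ step (sym-R e) here

mapʷ : ∀ {A B : Set} {R : A → A → Set} {Q : B → B → Set} (f : A → B)
     → (∀ {a b} → R a b → Q (f a) (f b)) → ∀ {x y} → Walk R x y → Walk Q (f x) (f y)
mapʷ f g here = here
mapʷ f g (step e w) = step (g e) (mapʷ f g w)

least-true : (p : ℕ → Bool) (n : ℕ) → T (p n) → Σ[ m ∈ ℕ ] (T (p m) × (∀ j → T (p j) → m ≤ j))
least-true p n pn with p 0 in p0
... | true  = 0 , subst T (sym p0) _ , λ _ _ → z≤n
... | false = shifted n pn
  where
  ¬p0 : ¬ T (p 0)
  ¬p0 = subst T p0
  shifted : ∀ n → T (p n) → Σ[ m ∈ ℕ ] (T (p m) × (∀ j → T (p j) → m ≤ j))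
  shifted zero p0′ = ⊥-elim (¬p0 p0′)
  shifted (suc n) pn with least-true (p ∘ suc) n pn
  ... | m , pm , minimal = suc m , pm , λ { zero pj → ⊥-elim (¬p0 pj) ; (suc j) pj → s≤s (minimal j pj) }

last-or-inject₁ : ∀ {n} (i : Fin (suc n)) → i ≡ fromℕ n ⊎ ∃[ j ] i ≡ inject₁ j
last-or-inject₁ {zero} fzero = inj₁ refl
last-or-inject₁ {suc n} fzero = inj₂ (fzero , refl)
last-or-inject₁ {suc n} (fsuc i) with last-or-inject₁ i
... | inj₁ i≡last = inj₁ (cong fsuc i≡last)
... | inj₂ (j , i≡j) = inj₂ (fsuc j , cong fsuc i≡j)

inject₁²≢suc² : ∀ {n} (i : Fin n) → inject₁ (inject₁ i) ≢ fsuc (fsuc i)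
inject₁²≢suc² i eq = <⇒≢ (m<n⇒m<1+n (n<1+n (toℕ i)))
  (trans (sym (trans (toℕ-inject₁ (inject₁ i)) (toℕ-inject₁ i))) (cong toℕ eq))

cycle-neighbours : {X : Graph} {F : Subgraph X} {k : ℕ} (c : Fin (3 + k) → V X)
  → (∀ (i : Fin (2 + k)) → Edge F (c (inject₁ i)) (c (fsuc i)))
  → Edge F (c (fromℕ (2 + k))) (c fzero)
  → ∀ i → Σ[ a ∈ Fin (3 + k) ] Σ[ b ∈ Fin (3 + k) ] (a ≢ b × Edge F (c i) (c a) × Edge F (c i) (c b))
cycle-neighbours {F = F} c next close fzero = fsuc fzero , fromℕ _ , (λ ()) , next fzero , Edge-sym F close
cycle-neighbours {F = F} {k} c next close (fsuc i) with last-or-inject₁ i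
... | inj₁ refl = inject₁ (fromℕ (1 + k)) , fzero , (λ ()) , Edge-sym F (next (fromℕ (1 + k))) , close
... | inj₂ (j , refl) =
  inject₁ (inject₁ j) , fsuc (fsuc j) , inject₁²≢suc² j , Edge-sym F (next (inject₁ j)) , next (fsuc j)

highest : ∀ {n} (f : Fin (suc n) → ℕ) → Σ[ i ∈ Fin (suc n) ] (∀ j → f j ≤ f i)
highest f = argmax f fzero (allFin _)
          , λ j → All.lookup (f[xs]≤f[argmax] {f = f} fzero (allFin _)) (∈-allFin j)

-- A highest vertex of a cycle has two distinct lower neighbours on it.
acyclic-by-height : {X : Graph} (F : Subgraph X) (h : V X → ℕ)
  → (∀ {x y} → Edge F x y → h x ≢ h y)
  → (∀ {x y z} → Edge F x y → Edge F x z → h y < h x → h z < h x → y ≡ z)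
  → ¬ Cycle F
acyclic-by-height F h h-differs lower-unique (k , c , c-injective , next , close) =
  from-top (highest (h ∘ c))
  where
  from-top : Σ[ top ∈ Fin (3 + k) ] (∀ j → h (c j) ≤ h (c top)) → ⊥
  from-top (top , top-highest) with cycle-neighbours {F = F} c next close top
  ... | a , b , a≢b , top-a , top-b = a≢b (c-injective (lower-unique top-a top-b (lower top-a) (lower top-b)))
    where
    lower : ∀ {j} → Edge F (c top) (c j) → h (c j) < h (c top)
    lower {j} e = ≤∧≢⇒< (top-highest j) (h-differs e ∘ sym)

record ParentTree (X : Graph) : Set where
  field
    member       : V X → Bool
    root         : V X
    parent       : V X → V X
    depth        : V X → ℕ
    parent-adj   : ∀ x → T (member x) → x ≢ root → T (adj X x (parent x))
    parent∈      : ∀ x → T (member x) → x ≢ root → T (member (parent x))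
    parent-depth : ∀ x → T (member x) → x ≢ root → depth (parent x) < depth x

module _ {X : Graph} (P : ParentTree X) where
  open ParentTree P

  ParentEdge : V X → V X → Set
  ParentEdge x y = T (member x) × x ≢ root × y ≡ parent x

  parentEdge : V X → V X → Bool
  parentEdge x y = member x ∧ (not (eqV X x root) ∧ eqV X y (parent x))

  parentEdge-sound : ∀ {x y} → T (parentEdge x y) → ParentEdge x y
  parentEdge-sound t with ∧-elim t
  ... | x∈ , rest with ∧-elim rest
  ...   | x≢root , y≡parent = x∈ , (not-elim x≢root ∘ eqV-complete X) , eqV-sound X y≡parent

  parentEdge-complete : ∀ {x} → T (member x) → x ≢ root → T (parentEdge x (parent x))
  parentEdge-complete x∈ x≢root =
    ∧-intro x∈ (∧-intro (not-intro (x≢root ∘ eqV-sound X)) (eqV-complete X refl))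

  treeEdge : V X → V X → Bool
  treeEdge x y = parentEdge x y ∨ parentEdge y x

  treeEdge-sound : ∀ {x y} → T (treeEdge x y) → ParentEdge x y ⊎ ParentEdge y x
  treeEdge-sound t with ∨-elim t
  ... | inj₁ xy = inj₁ (parentEdge-sound xy)
  ... | inj₂ yx = inj₂ (parentEdge-sound yx)

  parentSubgraph : Subgraph X
  parentSubgraph = record
    { inV    = member
    ; inE    = treeEdge
    ; E-sym  = λ x y → ∨-comm (parentEdge x y) (parentEdge y x)
    ; E-adj  = λ x y → edge-adj ∘ treeEdge-sound
    ; E-ends = λ x y → edge-end ∘ treeEdge-sound
    }
    where
    edge-adj : ∀ {x y} → ParentEdge x y ⊎ ParentEdge y x → T (adj X x y)
    edge-adj {x} (inj₁ (x∈ , x≢root , refl)) = parent-adj x x∈ x≢root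
    edge-adj {x} {y} (inj₂ (y∈ , y≢root , refl)) = subst T (adj-sym X y x) (parent-adj y y∈ y≢root)
    edge-end : ∀ {x y} → ParentEdge x y ⊎ ParentEdge y x → T (member x)
    edge-end (inj₁ (x∈ , _ , _)) = x∈
    edge-end {y = y} (inj₂ (y∈ , y≢root , refl)) = parent∈ y y∈ y≢root

  walk-to-root : ∀ n x → depth x < n → T (member x) → Walk (Edge parentSubgraph) x root
  walk-to-root (suc n) x (s≤s depth≤n) x∈ with decV X x root
  ... | yes refl = here
  ... | no x≢root = step (∨-introˡ (parentEdge-complete x∈ x≢root))
                         (walk-to-root n (parent x) (<-≤-trans (parent-depth x x∈ x≢root) depth≤n)
                                       (parent∈ x x∈ x≢root))

  parentSubgraph-isTree : IsTree parentSubgraph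
  parentSubgraph-isTree = connected , acyclic-by-height parentSubgraph depth depth-differs lower-is-parent
    where
    connected : SubConnected parentSubgraph
    connected x y x∈ y∈ = walk-to-root _ x (n<1+n _) x∈
                          ++ʷ reverseʷ (Edge-sym parentSubgraph) (walk-to-root _ y (n<1+n _) y∈)
    depth-differs : ∀ {x y} → Edge parentSubgraph x y → depth x ≢ depth y
    depth-differs e with treeEdge-sound e
    ... | inj₁ (x∈ , x≢root , refl) = <⇒≢ (parent-depth _ x∈ x≢root) ∘ sym
    ... | inj₂ (y∈ , y≢root , refl) = <⇒≢ (parent-depth _ y∈ y≢root)
    lower-parent : ∀ {x y} → Edge parentSubgraph x y → depth y < depth x → y ≡ parent x
    lower-parent e lower with treeEdge-sound e
    ... | inj₁ (_ , _ , y≡parent) = y≡parent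
    ... | inj₂ (y∈ , y≢root , refl) = ⊥-elim (<-asym lower (parent-depth _ y∈ y≢root))
    lower-is-parent : ∀ {x y z} → Edge parentSubgraph x y → Edge parentSubgraph x z
                    → depth y < depth x → depth z < depth x → y ≡ z
    lower-is-parent xy xz y< z< = trans (lower-parent xy y<) (sym (lower-parent xz z<))

module BreadthFirst (X : Graph) (r : V X) (connected : Connected X) where

  within : ℕ → V X → Bool
  within zero x = eqV X x r
  within (suc n) x = within n x ∨ any (λ y → within n y ∧ adj X x y) (vertices X)

  walk-within : ∀ {x} → Walk (λ a b → T (adj X a b)) x r → ∃[ n ] T (within n x)
  walk-within here = 0 , eqV-complete X refl
  walk-within {x} (step xy w) with walk-within w
  ... | n , y-within = suc n , ∨-introʳ {within n x}
                                  (any-vertex⁺ X (λ y → within n y ∧ adj X x y) (∧-intro y-within xy))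

  depth-spec : ∀ x → Σ[ n ∈ ℕ ] (T (within n x) × (∀ m → T (within m x) → n ≤ m))
  depth-spec x = least-true (λ n → within n x) (proj₁ (walk-within (connected x r)))
                                               (proj₂ (walk-within (connected x r)))

  depth : V X → ℕ
  depth x = proj₁ (depth-spec x)

  closer-neighbour : ∀ x n → T (within n x) → (∀ m → T (within m x) → n ≤ m)
    → Σ[ p ∈ V X ] (x ≢ r → T (adj X x p) × depth p < n)
  closer-neighbour x zero x≡r _ = r , λ x≢r → ⊥-elim (x≢r (eqV-sound X x≡r))
  closer-neighbour x (suc n) x-within minimal with ∨-elim {within n x} x-within
  ... | inj₁ earlier = ⊥-elim (<-irrefl refl (minimal n earlier))
  ... | inj₂ near with any-vertex⁻ X (λ y → within n y ∧ adj X x y) near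
  ...   | p , p-near = p , λ _ → proj₂ (∧-elim {within n p} p-near)
                               , s≤s (proj₂ (proj₂ (depth-spec p)) n (proj₁ (∧-elim {within n p} p-near)))

  parent-spec : ∀ x → Σ[ p ∈ V X ] (x ≢ r → T (adj X x p) × depth p < depth x)
  parent-spec x = closer-neighbour x (depth x) (proj₁ (proj₂ (depth-spec x))) (proj₂ (proj₂ (depth-spec x)))

  spanningTree : ParentTree X
  spanningTree = record
    { member       = λ _ → true
    ; root         = r
    ; parent       = λ x → proj₁ (parent-spec x)
    ; depth        = depth
    ; parent-adj   = λ x _ x≢r → proj₁ (proj₂ (parent-spec x) x≢r)
    ; parent∈      = λ _ _ _ → _
    ; parent-depth = λ x _ x≢r → proj₂ (proj₂ (parent-spec x) x≢r)
    }

InternallyDisjoint-sym : ∀ {X S} {t₁ t₂ : STree X S} → InternallyDisjoint t₁ t₂ → InternallyDisjoint t₂ t₁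
InternallyDisjoint-sym (no-common-edge , common⊆S) = (λ x y e₂ e₁ → no-common-edge x y e₁ e₂)
                                                    , (λ x p₂ p₁ → common⊆S x p₁ p₂)

HasTrees-zero : ∀ {X S} → HasTrees X S 0
HasTrees-zero = (λ ()) , (λ ())

HasTrees-≤ : ∀ {X S n r} → n ≤ r → HasTrees X S r → HasTrees X S n
HasTrees-≤ n≤r (ts , disjoint) = (λ i → ts (inject≤ i n≤r))
                               , λ i j i≢j → disjoint _ _ (i≢j ∘ inject≤-injective n≤r n≤r i j)

HasTrees-+ : ∀ {X S k d} (A : HasTrees X S k) (B : HasTrees X S d)
  → (∀ i j → InternallyDisjoint (proj₁ A i) (proj₁ B j)) → HasTrees X S (k + d)
HasTrees-+ {X} {S} {k} {d} (ts , ts-disjoint) (us , us-disjoint) cross =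
  trees ∘ Inverse.to +↔⊎ , λ i j i≢j → disjoint _ _ (i≢j ∘ Injection.injective (↔⇒↣ +↔⊎))
  where
  trees : Fin k ⊎ Fin d → STree X S
  trees = [ ts , us ]
  disjoint : ∀ p q → p ≢ q → InternallyDisjoint (trees p) (trees q)
  disjoint (inj₁ i) (inj₁ j) i≢j = ts-disjoint i j (i≢j ∘ cong inj₁)
  disjoint (inj₁ i) (inj₂ j) _   = cross i j
  disjoint (inj₂ i) (inj₁ j) _   = InternallyDisjoint-sym {t₁ = ts j} {us i} (cross j i)
  disjoint (inj₂ i) (inj₂ j) i≢j = us-disjoint i j (i≢j ∘ cong inj₂)

HasTrees-resp : ∀ {X S S′ r} → (∀ {z} → S z → S′ z) → (∀ {z} → S′ z → S z)
  → HasTrees X S r → HasTrees X S′ r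
HasTrees-resp S⊆S′ S′⊆S (ts , disjoint) =
  (λ i → record { tree = tree (ts i) ; isTree = isTree (ts i) ; S⊆V = λ x → S⊆V (ts i) x ∘ S′⊆S })
  , λ i j i≢j → proj₁ (disjoint i j i≢j) , λ x p q → S⊆S′ (proj₂ (disjoint i j i≢j) x p q)

IsMaximum : (ℕ → Set) → ℕ → Set
IsMaximum P m = P m × (∀ r → P r → r ≤ m)

module _ {P : ℕ → Set} (P-downward : ∀ {n r} → n ≤ r → P r → P n) (P-zero : P 0) where

  ¬¬-holds-or-maximum-below : ∀ n → ¬ ¬ (P n ⊎ ∃[ r ] (r < n × IsMaximum P r))
  ¬¬-holds-or-maximum-below zero ¬goal = ¬goal (inj₁ P-zero)
  ¬¬-holds-or-maximum-below (suc n) ¬goal = ¬¬-holds-or-maximum-below n λ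
    { (inj₁ Pn) → ¬goal (inj₂ (n , n<1+n n , Pn , bounded))
    ; (inj₂ (r , r<n , maximum)) → ¬goal (inj₂ (r , m<n⇒m<1+n r<n , maximum)) }
    where
    bounded : ∀ r → P r → r ≤ n
    bounded r Pr with r ≤? n
    ... | yes r≤n = r≤n
    ... | no r≰n = ⊥-elim (¬goal (inj₁ (P-downward (≰⇒> r≰n) Pr)))

  ¬¬-below-every-maximum : ∀ k → (∀ m → IsMaximum P m → k ≤ m) → ¬ ¬ P k
  ¬¬-below-every-maximum k below ¬Pk = ¬¬-holds-or-maximum-below k λ
    { (inj₁ Pk) → ¬Pk Pk
    ; (inj₂ (r , r<k , maximum)) → <-irrefl refl (<-≤-trans r<k (below r maximum)) }

trues-≥⇒injection : ∀ {n} (f : Fin n → Bool) d → d ≤ sum (tabulate (λ i → if f i then 1 else 0))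
  → Σ[ g ∈ (Fin d → Fin n) ] (Injective _≡_ _≡_ g × (∀ j → T (f (g j))))
trues-≥⇒injection f zero _ = (λ ()) , (λ { {()} }) , (λ ())
trues-≥⇒injection {suc n} f (suc d) d≤ with f fzero in f0
... | false with trues-≥⇒injection (f ∘ fsuc) (suc d) d≤
...   | g , g-injective , g-true = fsuc ∘ g , g-injective ∘ suc-injective , g-true
trues-≥⇒injection {suc n} f (suc d) (s≤s d≤) | true with trues-≥⇒injection (f ∘ fsuc) d d≤
... | g , g-injective , g-true = g′ , g′-injective , g′-true
  where
  g′ : Fin (suc d) → Fin (suc n)
  g′ fzero = fzero
  g′ (fsuc j) = fsuc (g j)
  g′-injective : Injective _≡_ _≡_ g′
  g′-injective {fzero} {fzero} _ = refl
  g′-injective {fsuc i} {fsuc j} e = cong fsuc (g-injective (suc-injective e))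
  g′-true : ∀ j → T (f (g′ j))
  g′-true fzero = subst T (sym f0) _
  g′-true (fsuc j) = g-true j

distinct-neighbours : (H : Graph) (v : V H) (d : ℕ) → d ≤ deg H v
  → Σ[ w ∈ (Fin d → V H) ] (Injective _≡_ _≡_ w × (∀ j → T (adj H v (w j))))
distinct-neighbours H v d d≤deg
  with trues-≥⇒injection (λ i → adj H v (fromV H i)) d
         (subst (d ≤_) (cong sum (map-tabulate (λ i → i) (λ i → if adj H v (fromV H i) then 1 else 0))) d≤deg)
... | g , g-injective , adjacent = fromV H ∘ g , g-injective ∘ fromV-injective H , adjacent

_↑_ : {A B : Set} → (A → Set) → B → A × B → Set
(S ↑ v) z = S (proj₁ z) × proj₂ z ≡ v

Three-↑ : {A B : Set} {a b c : A} {v : B} {z : A × B} → Three (a , v) (b , v) (c , v) z → (Three a b c ↑ v) z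
Three-↑ (inj₁ refl) = inj₁ refl , refl
Three-↑ (inj₂ (inj₁ refl)) = inj₂ (inj₁ refl) , refl
Three-↑ (inj₂ (inj₂ refl)) = inj₂ (inj₂ refl) , refl

↑-Three : {A B : Set} {a b c : A} {v : B} {z : A × B} → (Three a b c ↑ v) z → Three (a , v) (b , v) (c , v) z
↑-Three (inj₁ refl , refl) = inj₁ refl
↑-Three (inj₂ (inj₁ refl) , refl) = inj₂ (inj₁ refl)
↑-Three (inj₂ (inj₂ refl) , refl) = inj₂ (inj₂ refl)

Three? : {A : Set} → DecidableEquality A → (a b c : A) → Decidable (Three a b c)
Three? _≟_ a b c x = x ≟ a ⊎-dec x ≟ b ⊎-dec x ≟ c

module Product (G H : Graph) (v : V H) where

  layerV : Subgraph G → V (G □ H) → Bool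
  layerV F z = inV F (proj₁ z) ∧ eqV H (proj₂ z) v

  layerE : Subgraph G → V (G □ H) → V (G □ H) → Bool
  layerE F z z′ = inE F (proj₁ z) (proj₁ z′) ∧ (eqV H (proj₂ z) v ∧ eqV H (proj₂ z′) v)

  layerV-sound : ∀ F {z} → T (layerV F z) → T (inV F (proj₁ z)) × proj₂ z ≡ v
  layerV-sound F {z} t with ∧-elim {inV F (proj₁ z)} t
  ... | x∈ , y≡v = x∈ , eqV-sound H y≡v

  layerE-sound : ∀ F {z z′} → T (layerE F z z′) → Edge F (proj₁ z) (proj₁ z′) × proj₂ z ≡ v × proj₂ z′ ≡ v
  layerE-sound F {z} {z′} t with ∧-elim {inE F (proj₁ z) (proj₁ z′)} t
  ... | e , ends with ∧-elim {eqV H (proj₂ z) v} ends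
  ...   | y≡v , y′≡v = e , eqV-sound H y≡v , eqV-sound H y′≡v

  layerE-complete : ∀ F {x x′} → Edge F x x′ → T (layerE F (x , v) (x′ , v))
  layerE-complete F e = ∧-intro e (∧-intro (eqV-complete H refl) (eqV-complete H refl))

  layer-adj : ∀ {x x′} → T (adj G x x′) → T (adj (G □ H) (x , v) (x′ , v))
  layer-adj {x} {x′} a = ∨-introʳ {eqV G x x′ ∧ adj H v v} (∧-intro (eqV-complete H refl) a)

  layer : Subgraph G → Subgraph (G □ H)
  layer F = record
    { inV    = layerV F
    ; inE    = layerE F
    ; E-sym  = λ z z′ → cong₂ _∧_ (E-sym F _ _) (∧-comm (eqV H (proj₂ z) v) _)
    ; E-adj  = λ z z′ → edge-adj ∘ layerE-sound F {z} {z′}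
    ; E-ends = λ z z′ → edge-end ∘ layerE-sound F {z} {z′}
    }
    where
    edge-adj : ∀ {z z′} → Edge F (proj₁ z) (proj₁ z′) × proj₂ z ≡ v × proj₂ z′ ≡ v → T (adj (G □ H) z z′)
    edge-adj {x , _} {x′ , _} (e , refl , refl) = layer-adj (E-adj F x x′ e)
    edge-end : ∀ {z z′} → Edge F (proj₁ z) (proj₁ z′) × proj₂ z ≡ v × proj₂ z′ ≡ v → T (layerV F z)
    edge-end {x , _} {x′ , _} (e , refl , _) = ∧-intro (E-ends F x x′ e) (eqV-complete H refl)

  layer-isTree : ∀ F → IsTree F → IsTree (layer F)
  layer-isTree F (F-connected , F-acyclic) = connected , acyclic
    where
    connected : SubConnected (layer F)
    connected (x , _) (x′ , _) p q with layerV-sound F p | layerV-sound F q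
    ... | x∈ , refl | x′∈ , refl = mapʷ (_, v) (layerE-complete F) (F-connected x x′ x∈ x′∈)
    acyclic : ¬ Cycle (layer F)
    acyclic (k , c , c-injective , next , close) =
      F-acyclic (k , proj₁ ∘ c , proj₁-injective , proj₁ ∘ layerE-sound F ∘ next , proj₁ (layerE-sound F close))
      where
      in-layer : ∀ i → proj₂ (c i) ≡ v
      in-layer i with cycle-neighbours {F = layer F} c next close i
      ... | _ , _ , _ , e , _ = proj₁ (proj₂ (layerE-sound F {c i} e))
      proj₁-injective : Injective _≡_ _≡_ (proj₁ ∘ c)
      proj₁-injective {i} {j} e = c-injective (cong₂ _,_ e (trans (in-layer i) (sym (in-layer j))))

  liftTree : ∀ {S} → STree G S → STree (G □ H) (S ↑ v)
  liftTree t = record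
    { tree   = layer (tree t)
    ; isTree = layer-isTree (tree t) (isTree t)
    ; S⊆V    = λ { (x , _) (s , refl) → ∧-intro (S⊆V t x s) (eqV-complete H refl) }
    }

  liftTree-disjoint : ∀ {S} (t₁ t₂ : STree G S) → InternallyDisjoint t₁ t₂
    → InternallyDisjoint (liftTree t₁) (liftTree t₂)
  liftTree-disjoint t₁ t₂ (no-common-edge , common⊆S) =
      (λ z z′ e₁ e₂ → no-common-edge _ _ (proj₁ (layerE-sound (tree t₁) e₁)) (proj₁ (layerE-sound (tree t₂) e₂)))
    , (λ z p₁ p₂ → common⊆S _ (proj₁ (layerV-sound (tree t₁) p₁)) (proj₁ (layerV-sound (tree t₂) p₂))
                 , proj₂ (layerV-sound (tree t₁) p₁))

  liftTrees : ∀ {S k} → HasTrees G S k → HasTrees (G □ H) (S ↑ v) k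
  liftTrees (ts , disjoint) = liftTree ∘ ts , λ i j i≢j → liftTree-disjoint (ts i) (ts j) (disjoint i j i≢j)

  module Bridge (P : ParentTree G) (spanning : ∀ x → T (ParentTree.member P x))
                {S : V G → Set} (S? : Decidable S) where
    open ParentTree P using (root; parent; depth; parent-adj; parent-depth)

    -- For a neighbour w of v: a spanning tree of layer w with the points (x, v), x ∈ S,
    -- hung below (x, w).
    module _ (w : V H) (vw : T (adj H v w)) where

      bridgeMember : V (G □ H) → Bool
      bridgeMember z = eqV H (proj₂ z) w ∨ (eqV H (proj₂ z) v ∧ ⌊ S? (proj₁ z) ⌋)

      bridgeMember-sound : ∀ {z} → T (bridgeMember z) → proj₂ z ≡ w ⊎ (S ↑ v) z
      bridgeMember-sound {x , y} t with ∨-elim {eqV H y w} t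
      ... | inj₁ y≡w = inj₁ (eqV-sound H y≡w)
      ... | inj₂ at-v with ∧-elim {eqV H y v} at-v
      ...   | y≡v , s = inj₂ (toWitness s , eqV-sound H y≡v)

      bridgeParent : V (G □ H) → V (G □ H)
      bridgeParent (x , y) with decV H y w
      ... | yes _ = parent x , w
      ... | no _  = x , w

      bridgeDepth : V (G □ H) → ℕ
      bridgeDepth (x , y) with decV H y w
      ... | yes _ = depth x
      ... | no _  = suc (depth x)

      bridgeParent-in-w : ∀ z → proj₂ (bridgeParent z) ≡ w
      bridgeParent-in-w (x , y) with decV H y w
      ... | yes _ = refl
      ... | no _  = refl

      bridgeDepth-in-w : ∀ x → bridgeDepth (x , w) ≡ depth x
      bridgeDepth-in-w x with decV H w w
      ... | yes _ = refl
      ... | no w≢w = ⊥-elim (w≢w refl)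

      bridge : ParentTree (G □ H)
      bridge = record
        { member       = bridgeMember
        ; root         = root , w
        ; parent       = bridgeParent
        ; depth        = bridgeDepth
        ; parent-adj   = bridge-adj
        ; parent∈      = λ z _ _ → subst (λ y → T (bridgeMember (proj₁ (bridgeParent z) , y)))
                                         (sym (bridgeParent-in-w z)) (∨-introˡ (eqV-complete H refl))
        ; parent-depth = bridge-depth
        }
        where
        bridge-adj : ∀ z → T (bridgeMember z) → z ≢ (root , w) → T (adj (G □ H) z (bridgeParent z))
        bridge-adj (x , y) z∈ z≢root with decV H y w | bridgeMember-sound {x , y} z∈
        ... | yes refl | _ = ∨-introʳ {eqV G x (parent x) ∧ adj H w w}
                               (∧-intro (eqV-complete H refl) (parent-adj x (spanning x) (z≢root ∘ cong (_, w))))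
        ... | no y≢w | inj₁ y≡w = ⊥-elim (y≢w y≡w)
        ... | no _ | inj₂ (_ , refl) = ∨-introˡ (∧-intro (eqV-complete G refl) vw)
        bridge-depth : ∀ z → T (bridgeMember z) → z ≢ (root , w) → bridgeDepth (bridgeParent z) < bridgeDepth z
        bridge-depth (x , y) _ z≢root with decV H y w
        ... | yes refl = subst (_< depth x) (sym (bridgeDepth-in-w (parent x)))
                               (parent-depth x (spanning x) (z≢root ∘ cong (_, w)))
        ... | no _ = subst (_< suc (depth x)) (sym (bridgeDepth-in-w x)) (n<1+n _)

      bridgeTree : STree (G □ H) (S ↑ v)
      bridgeTree = record
        { tree   = parentSubgraph bridge
        ; isTree = parentSubgraph-isTree bridge
        ; S⊆V    = λ { (x , _) (s , refl) → ∨-introʳ {eqV H v w} (∧-intro (eqV-complete H refl) (fromWitness s)) }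
        }

      bridge-edge-in-w : ∀ {z z′} → Edge (parentSubgraph bridge) z z′ → proj₂ z ≡ w ⊎ proj₂ z′ ≡ w
      bridge-edge-in-w e with treeEdge-sound bridge e
      ... | inj₁ (_ , _ , refl) = inj₂ (bridgeParent-in-w _)
      ... | inj₂ (_ , _ , refl) = inj₁ (bridgeParent-in-w _)


    liftTree-bridge-disjoint : ∀ (t : STree G S) {w} (vw : T (adj H v w))
      → InternallyDisjoint (liftTree t) (bridgeTree w vw)
    liftTree-bridge-disjoint t {w} vw = no-common-edge , common⊆S
      where
      no-common-edge : ∀ z z′ → Edge (layer (tree t)) z z′ → Edge (parentSubgraph (bridge w vw)) z z′ → ⊥
      no-common-edge z z′ e₁ e₂ with layerE-sound (tree t) e₁ | bridge-edge-in-w w vw e₂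
      ... | _ , refl , _ | inj₁ v≡w = adj⇒≢ H vw v≡w
      ... | _ , _ , refl | inj₂ v≡w = adj⇒≢ H vw v≡w
      common⊆S : ∀ z → T (layerV (tree t) z) → T (bridgeMember w vw z) → (S ↑ v) z
      common⊆S z p q with layerV-sound (tree t) p | bridgeMember-sound w vw q
      ... | _ , refl | inj₁ v≡w = ⊥-elim (adj⇒≢ H vw v≡w)
      ... | _ | inj₂ s = s

    bridge-disjoint : ∀ {w₁ w₂} (vw₁ : T (adj H v w₁)) (vw₂ : T (adj H v w₂)) → w₁ ≢ w₂
      → InternallyDisjoint (bridgeTree w₁ vw₁) (bridgeTree w₂ vw₂)
    bridge-disjoint {w₁} {w₂} vw₁ vw₂ w₁≢w₂ = no-common-edge , common⊆S
      where
      tree₂ : Subgraph (G □ H)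
      tree₂ = parentSubgraph (bridge w₂ vw₂)
      outside₂ : ∀ z → proj₂ z ≡ w₁ → ¬ T (bridgeMember w₂ vw₂ z)
      outside₂ z refl z∈ with bridgeMember-sound w₂ vw₂ z∈
      ... | inj₁ w₁≡w₂ = w₁≢w₂ w₁≡w₂
      ... | inj₂ (_ , w₁≡v) = adj⇒≢ H vw₁ (sym w₁≡v)
      no-common-edge : ∀ z z′ → Edge (parentSubgraph (bridge w₁ vw₁)) z z′ → Edge tree₂ z z′ → ⊥
      no-common-edge z z′ e₁ e₂ with bridge-edge-in-w w₁ vw₁ e₁
      ... | inj₁ z-in-w₁ = outside₂ z z-in-w₁ (E-ends tree₂ z z′ e₂)
      ... | inj₂ z′-in-w₁ = outside₂ z′ z′-in-w₁ (E-ends tree₂ z′ z (Edge-sym tree₂ e₂))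
      common⊆S : ∀ z → T (bridgeMember w₁ vw₁ z) → T (bridgeMember w₂ vw₂ z) → (S ↑ v) z
      common⊆S z p q with bridgeMember-sound w₁ vw₁ p
      ... | inj₁ z-in-w₁ = ⊥-elim (outside₂ z z-in-w₁ q)
      ... | inj₂ s = s

    bridgeTrees : ∀ {d} (ws : Fin d → V H) → Injective _≡_ _≡_ ws → (∀ j → T (adj H v (ws j)))
      → HasTrees (G □ H) (S ↑ v) d
    bridgeTrees ws ws-injective adjacent =
      (λ j → bridgeTree (ws j) (adjacent j))
      , λ i j i≢j → bridge-disjoint (adjacent i) (adjacent j) (i≢j ∘ ws-injective)

  product-trees : Connected G → V G → ∀ {S} → Decidable S → ∀ {k d}
    → HasTrees G S k
    → Σ[ ws ∈ (Fin d → V H) ] (Injective _≡_ _≡_ ws × (∀ j → T (adj H v (ws j))))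
    → HasTrees (G □ H) (S ↑ v) (k + d)
  product-trees G-connected r S? (ts , ts-disjoint) (ws , ws-injective , adjacent) =
    HasTrees-+ (liftTrees (ts , ts-disjoint)) (bridgeTrees ws ws-injective adjacent)
               (λ i j → liftTree-bridge-disjoint (ts i) (adjacent j))
    where
    open Bridge (BreadthFirst.spanningTree G r G-connected) (λ _ → _) S?

lemma3p4 : (G H : Graph) → Nontrivial G → Nontrivial H → Connected G → Connected H
    → (u₁ u₂ u₃ : V G) → Distinct3 u₁ u₂ u₃ → (v₁ : V H)
    → (k d m : ℕ) → IsKappa3 G k → IsMinDeg H d
    → IsKappa (G □ H) (Three (u₁ , v₁) (u₂ , v₁) (u₃ , v₁)) m
    → k + d ≤ m
lemma3p4 G H _ _ G-connected _ u₁ u₂ u₃ u-distinct v₁ k d m (κ₃-least , _) (δ-least , _) (_ , m-maximum) =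
  decidable-stable (k + d ≤? m) (¬¬-map (m-maximum (k + d) ∘ extend) G-has-k-trees)
  where
  G-has-k-trees : ¬ ¬ HasTrees G (Three u₁ u₂ u₃) k
  G-has-k-trees = ¬¬-below-every-maximum HasTrees-≤ HasTrees-zero k (κ₃-least u₁ u₂ u₃ u-distinct)
  extend : HasTrees G (Three u₁ u₂ u₃) k → HasTrees (G □ H) (Three (u₁ , v₁) (u₂ , v₁) (u₃ , v₁)) (k + d)
  extend ts = HasTrees-resp ↑-Three Three-↑
    (Product.product-trees G H v₁ G-connected u₁ (Three? (decV G) u₁ u₂ u₃) ts
                           (distinct-neighbours H v₁ d (δ-least v₁)))
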